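{- Let $n\ge 1$, $m\ge 0$ and $1\le r\le k$ be integers. Then \[ \sum_{q=0}^{m}(-1)^{q}\binom{m+k}{q}S(m+k-q, k)\,S_q^{(r)}(n) =\frac{1}{\binom{k}{r}}\sum_{j=0}^{m}(-1)^j\binom{m+k}{m+k-r-j}S(m+k-r-j, k-r)\,S(r+j, r)\,n^{r+j}. \]
   Context: For positive integers $n,r$ and integers $q\ge 0$, the higher order power sums $S^{(r)}_q(n)$ are defined by the exponential generating function \[ \Big(\sum_{p=1}^{n}e^{pt}\Big)^r=\sum_{q\ge 0}S^{(r)}_q(n)\frac{t^q}{q!}. \] $S(a,b)$ denotes the Stirling numbers of the second kind, determined by $(e^t-1)^b=b!\sum_{a\ge 0}S(a,b)\frac{t^a}{a!}$ for all $b\ge 0$. -}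

module Defs where

open import Data.Nat using (ℕ; zero; suc; _+_; _*_; _^_; _≤_; _<_; z≤n; s≤s; NonZero; >-nonZero)
open import Data.Nat.Properties using (<-≤-trans; m≤m+n)
open import Data.Nat.Combinatorics using (_C_; nCk≡nC[n∸k]; nCn≡1; nCk+nC[k+1]≡[n+1]C[k+1])
open import Data.Integer as ℤ using (ℤ)
open import Relation.Binary.PropositionalEquality using (_≡_; sym; trans; subst)

sumTo : ℕ → (ℕ → ℤ) → ℤ
sumTo zero    f = f 0
sumTo (suc m) f = sumTo m f ℤ.+ f (suc m)

sum1 : ℕ → (ℕ → ℕ) → ℕ
sum1 zero    f = 0
sum1 (suc n) f = sum1 n f + f (suc n)

sgn : ℕ → ℤ
sgn zero    = ℤ.+ 1
sgn (suc q) = ℤ.- sgn q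

-- Stirling numbers of the second kind S(a,b), via the standard recurrence
-- (equivalent to (e^t-1)^b = b! Σ_a S(a,b) t^a/a!).
stirling2 : ℕ → ℕ → ℕ
stirling2 zero    zero    = 1
stirling2 zero    (suc b) = 0
stirling2 (suc a) zero    = 0
stirling2 (suc a) (suc b) = suc b * stirling2 a (suc b) + stirling2 a b

-- tupleSum r n c q = Σ_{p₁,…,p_r ∈ {1..n}} (c + p₁ + … + p_r)^q
tupleSum : ℕ → ℕ → ℕ → ℕ → ℕ
tupleSum zero    n c q = c ^ q
tupleSum (suc r) n c q = sum1 n (λ p → tupleSum r n (c + p) q)

-- Higher order power sum S^{(r)}_q(n): coefficient of t^q/q! in (Σ_{p=1}^n e^{pt})^r,
-- i.e. Σ over r-tuples in {1..n}^r of (p₁+…+p_r)^q.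
powerSum : (r q n : ℕ) → ℕ
powerSum r q n = tupleSum r n 0 q

C-pos : ∀ k r → r ≤ k → 0 < k C r
C-pos k zero _ = subst (0 <_) (sym (trans (nCk≡nC[n∸k] {0} {k} z≤n) (nCn≡1 k))) (s≤s z≤n)
C-pos (suc k) (suc r) (s≤s r≤k) =
  subst (0 <_) (nCk+nC[k+1]≡[n+1]C[k+1] k r) (<-≤-trans (C-pos k r r≤k) (m≤m+n _ _))

C-nonZero : ∀ {k r} → r ≤ k → NonZero (k C r)
C-nonZero {k} {r} r≤k = >-nonZero (C-pos k r r≤k)

module Submission where

-- Work with exponential polynomials Σ aᵢ e^{cᵢ t} (integers aᵢ, cᵢ) and their Taylor
-- coefficients; products multiply coefficients by binomial convolution.  With
--   Y = Σ_{p=1}^{n} e^{−pt},   X = e^t − 1,   Z = 1 − e^{−nt}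
-- the coefficients of Y^r are (−1)^q S_q^{(r)}(n), those of X^k are k! S(N,k) (via the power rule
-- for derivatives), and Y X = Z telescopes.  For N = m + k and j = k − r this gives
--   k! · LHS = coeff_N (Y^r X^k) = coeff_N (Z^r X^j) = r! j! · RHS,
-- where Z^r = (−1)^r (e^{−nt} − 1)^r is a dilated power of X, and both convolutions reduce to the
-- stated ranges because S(a,b) = 0 for a < b.  As k! = C(k,r) r! j!, the theorem follows.

module PowerSumIdentity where
  open import Defs
  open import Data.Nat as ℕ using (ℕ; zero; suc; _∸_; _≤_; _<_; z≤n; s≤s; _!; NonZero)
  import Data.Nat.Properties as ℕP
  import Data.Nat.Tactic.RingSolver as ℕSolver
  open import Data.Nat.Combinatorics using (_C_; nCk≡nC[n∸k]; nCk≡n!/k![n-k]!; k![n∸k]!∣n!)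
  open import Data.Nat.DivMod using (m/n*n≡m)
  open import Data.Integer using (ℤ; -_; _+_; _-_; _*_; _^_; 0ℤ; 1ℤ; -1ℤ) renaming (+_ to ι)
  import Data.Integer.Properties as ℤP
  open import Data.Integer.Tactic.RingSolver using (solve-∀)
  open import Data.Rational using (_/_)
  open import Data.Rational.Unnormalised using (mkℚᵘ; *≡*)
  open import Data.Rational.Properties using (fromℚᵘ-cong)
  open import Data.Fin using (toℕ)
  open import Data.Product using (_×_; _,_)
  open import Data.List using (List; []; _∷_; _++_)
  import Data.List.Properties as ListP
  import Algebra.Properties.CommutativeSemiring.Binomial ℤP.+-*-commutativeSemiring as Binomial
  open import Algebra.Properties.CommutativeSemiring.Exp ℤP.+-*-commutativeSemiring using (^-distrib-*) renaming (_^_ to _^ₛ_)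
  open import Algebra.Properties.Semiring.Sum ℤP.+-*-semiring using (sum; sum-cong-≗)
  open import Algebra.Definitions.RawMonoid Data.Integer.+-0-rawMonoid using () renaming (_×_ to _·ₙ_)
  open import Relation.Binary.PropositionalEquality
  open ≡-Reasoning

  sumTo-cong≤ : ∀ N {f g : ℕ → ℤ} → (∀ q → q ≤ N → f q ≡ g q) → sumTo N f ≡ sumTo N g
  sumTo-cong≤ zero    f≗g = f≗g 0 z≤n
  sumTo-cong≤ (suc N) f≗g =
    cong₂ _+_ (sumTo-cong≤ N λ q q≤N → f≗g q (ℕP.m≤n⇒m≤1+n q≤N)) (f≗g (suc N) ℕP.≤-refl)

  sumTo-cong : ∀ N {f g : ℕ → ℤ} → (∀ q → f q ≡ g q) → sumTo N f ≡ sumTo N g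
  sumTo-cong N f≗g = sumTo-cong≤ N λ q _ → f≗g q

  sumTo-zero : ∀ N → sumTo N (λ _ → 0ℤ) ≡ 0ℤ
  sumTo-zero zero    = refl
  sumTo-zero (suc N) = cong (_+ 0ℤ) (sumTo-zero N)

  sumTo-+ : ∀ N (f g : ℕ → ℤ) → sumTo N (λ q → f q + g q) ≡ sumTo N f + sumTo N g
  sumTo-+ zero    f g = refl
  sumTo-+ (suc N) f g =
    trans (cong (_+ (f (suc N) + g (suc N))) (sumTo-+ N f g)) (swap (sumTo N f) (sumTo N g) (f (suc N)) (g (suc N)))
    where swap : ∀ a b c d → (a + b) + (c + d) ≡ (a + c) + (b + d)
          swap = solve-∀

  sumTo-*ˡ : ∀ N a (f : ℕ → ℤ) → sumTo N (λ q → a * f q) ≡ a * sumTo N f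
  sumTo-*ˡ zero    a f = refl
  sumTo-*ˡ (suc N) a f = trans (cong (_+ a * f (suc N)) (sumTo-*ˡ N a f)) (sym (ℤP.*-distribˡ-+ a _ _))

  sumTo-first : ∀ N (f : ℕ → ℤ) → sumTo (suc N) f ≡ f 0 + sumTo N (λ q → f (suc q))
  sumTo-first zero    f = refl
  sumTo-first (suc N) f = trans (cong (_+ f (suc (suc N))) (sumTo-first N f)) (ℤP.+-assoc (f 0) _ _)

  sumTo-split : ∀ a b (f : ℕ → ℤ) → sumTo (a ℕ.+ suc b) f ≡ sumTo a f + sumTo b (λ i → f (suc a ℕ.+ i))
  sumTo-split a zero    f rewrite ℕP.+-comm a 1 | ℕP.+-identityʳ a = refl
  sumTo-split a (suc b) f rewrite ℕP.+-suc a (suc b) =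
    trans (cong (_+ f (suc (a ℕ.+ suc b))) (sumTo-split a b f)) (ℤP.+-assoc (sumTo a f) _ _)

  sumTo-vanishing-tail : ∀ m d (f : ℕ → ℤ) → (∀ q → m < q → q ≤ m ℕ.+ d → f q ≡ 0ℤ) →
    sumTo (m ℕ.+ d) f ≡ sumTo m f
  sumTo-vanishing-tail m zero    f _ = cong (λ x → sumTo x f) (ℕP.+-identityʳ m)
  sumTo-vanishing-tail m (suc d) f f≡0 rewrite ℕP.+-suc m d = begin
    sumTo (m ℕ.+ d) f + f (suc (m ℕ.+ d)) ≡⟨ cong (sumTo (m ℕ.+ d) f +_) (f≡0 _ (s≤s (ℕP.m≤m+n m d)) ℕP.≤-refl) ⟩
    sumTo (m ℕ.+ d) f + 0ℤ                ≡⟨ ℤP.+-identityʳ _ ⟩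
    sumTo (m ℕ.+ d) f                     ≡⟨ sumTo-vanishing-tail m d f (λ q m<q q≤ → f≡0 q m<q (ℕP.m≤n⇒m≤1+n q≤)) ⟩
    sumTo m f                             ∎

  sumTo≡∑ : ∀ N (f : ℕ → ℤ) → sumTo N f ≡ sum {suc N} (λ i → f (toℕ i))
  sumTo≡∑ zero    f = sym (ℤP.+-identityʳ (f 0))
  sumTo≡∑ (suc N) f = trans (sumTo-first N f) (cong (f 0 +_) (sumTo≡∑ N (λ q → f (suc q))))

  ·ₙ≡* : ∀ n x → n ·ₙ x ≡ ι n * x
  ·ₙ≡* zero    x = sym (ℤP.*-zeroˡ x)
  ·ₙ≡* (suc n) x = begin
    x + n ·ₙ x        ≡⟨ cong₂ _+_ (sym (ℤP.*-identityˡ x)) (·ₙ≡* n x) ⟩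
    1ℤ * x + ι n * x ≡⟨ sym (ℤP.*-distribʳ-+ x 1ℤ (ι n)) ⟩
    (1ℤ + ι n) * x   ≡⟨ cong (_* x) (sym (ℤP.pos-+ 1 n)) ⟩
    ι (suc n) * x    ∎

  ^ₛ≡^ : ∀ x n → x ^ₛ n ≡ x ^ n
  ^ₛ≡^ x zero    = refl
  ^ₛ≡^ x (suc n) = cong (x *_) (^ₛ≡^ x n)

  ^-distrib-*′ : ∀ x y N → (x * y) ^ N ≡ x ^ N * y ^ N
  ^-distrib-*′ x y N = begin
    (x * y) ^ N        ≡⟨ sym (^ₛ≡^ (x * y) N) ⟩
    (x * y) ^ₛ N       ≡⟨ ^-distrib-* x y N ⟩
    x ^ₛ N * y ^ₛ N    ≡⟨ cong₂ _*_ (^ₛ≡^ x N) (^ₛ≡^ y N) ⟩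
    x ^ N * y ^ N      ∎

  binomial : ∀ c d N → (c + d) ^ N ≡ sumTo N (λ q → ι (N C q) * c ^ q * d ^ (N ∸ q))
  binomial c d N = begin
    (c + d) ^ N ≡⟨ sym (^ₛ≡^ (c + d) N) ⟩
    (c + d) ^ₛ N ≡⟨ Binomial.theorem N c d ⟩
    sum {suc N} (λ i → (N C toℕ i) ·ₙ (c ^ₛ toℕ i * d ^ₛ (N ∸ toℕ i)))
      ≡⟨ sum-cong-≗ {suc N} (λ i → term (N C toℕ i) (toℕ i)) ⟩
    sum {suc N} (λ i → ι (N C toℕ i) * c ^ toℕ i * d ^ (N ∸ toℕ i))
      ≡⟨ sym (sumTo≡∑ N _) ⟩
    sumTo N (λ q → ι (N C q) * c ^ q * d ^ (N ∸ q)) ∎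
    where
    term : ∀ b q → b ·ₙ (c ^ₛ q * d ^ₛ (N ∸ q)) ≡ ι b * c ^ q * d ^ (N ∸ q)
    term b q = begin
      b ·ₙ (c ^ₛ q * d ^ₛ (N ∸ q)) ≡⟨ ·ₙ≡* b _ ⟩
      ι b * (c ^ₛ q * d ^ₛ (N ∸ q)) ≡⟨ cong₂ (λ x y → ι b * (x * y)) (^ₛ≡^ c q) (^ₛ≡^ d (N ∸ q)) ⟩
      ι b * (c ^ q * d ^ (N ∸ q)) ≡⟨ sym (ℤP.*-assoc (ι b) _ _) ⟩
      ι b * c ^ q * d ^ (N ∸ q) ∎

  -- An exponential polynomial  Σᵢ aᵢ e^{cᵢ t}  with integer coefficients aᵢ and frequencies cᵢ,
  -- represented by the list of pairs (aᵢ , cᵢ).  List concatenation '_++_' is the sum of functions.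
  ExpPoly : Set
  ExpPoly = List (ℤ × ℤ)

  -- coeff L N = Σᵢ aᵢ cᵢ^N is the N-th derivative at t = 0, i.e. the N-th coefficient of L as an
  -- exponential generating function.
  coeff : ExpPoly → ℕ → ℤ
  coeff []            N = 0ℤ
  coeff ((a , c) ∷ L) N = a * c ^ N + coeff L N

  infix 4 _≈_
  record _≈_ (L M : ExpPoly) : Set where
    field at : ∀ N → coeff L N ≡ coeff M N
  open _≈_ public

  ≈-trans : ∀ {L M P} → L ≈ M → M ≈ P → L ≈ P
  ≈-trans L≈M M≈P .at N = trans (L≈M .at N) (M≈P .at N)

  ≡⇒≈ : ∀ {L M} → L ≡ M → L ≈ M
  ≡⇒≈ refl .at N = refl

  scale : ℤ → ExpPoly → ExpPoly
  scale a []            = []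
  scale a ((b , d) ∷ L) = (a * b , d) ∷ scale a L

  shift : ℤ → ExpPoly → ExpPoly
  shift c []            = []
  shift c ((b , d) ∷ L) = (b , c + d) ∷ shift c L

  dilate : ℤ → ExpPoly → ExpPoly
  dilate e []            = []
  dilate e ((b , d) ∷ L) = (b , e * d) ∷ dilate e L

  deriv : ExpPoly → ExpPoly
  deriv []            = []
  deriv ((b , d) ∷ L) = (b * d , d) ∷ deriv L

  infixl 7 _⊗_
  _⊗_ : ExpPoly → ExpPoly → ExpPoly
  []            ⊗ M = []
  ((a , c) ∷ L) ⊗ M = scale a (shift c M) ++ L ⊗ M

  one : ExpPoly
  one = (1ℤ , 0ℤ) ∷ []

  infixr 8 _^⊗_
  _^⊗_ : ExpPoly → ℕ → ExpPoly
  A ^⊗ zero  = one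
  A ^⊗ suc r = A ⊗ A ^⊗ r

  coeff-++ : ∀ L M N → coeff (L ++ M) N ≡ coeff L N + coeff M N
  coeff-++ []            M N = sym (ℤP.+-identityˡ _)
  coeff-++ ((a , c) ∷ L) M N =
    trans (cong (a * c ^ N +_) (coeff-++ L M N)) (sym (ℤP.+-assoc (a * c ^ N) (coeff L N) (coeff M N)))

  coeff-scale : ∀ a L N → coeff (scale a L) N ≡ a * coeff L N
  coeff-scale a []            N = sym (ℤP.*-zeroʳ a)
  coeff-scale a ((b , d) ∷ L) N =
    trans (cong₂ _+_ (ℤP.*-assoc a b _) (coeff-scale a L N)) (sym (ℤP.*-distribˡ-+ a _ _))

  coeff-dilate : ∀ e L N → coeff (dilate e L) N ≡ e ^ N * coeff L N
  coeff-dilate e []            N = sym (ℤP.*-zeroʳ (e ^ N))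
  coeff-dilate e ((b , d) ∷ L) N = begin
    b * (e * d) ^ N + coeff (dilate e L) N       ≡⟨ cong₂ _+_ (cong (b *_) (^-distrib-*′ e d N)) (coeff-dilate e L N) ⟩
    b * (e ^ N * d ^ N) + e ^ N * coeff L N      ≡⟨ factor b (e ^ N) (d ^ N) (coeff L N) ⟩
    e ^ N * (b * d ^ N + coeff L N)              ∎
    where factor : ∀ b x y z → b * (x * y) + x * z ≡ x * (b * y + z)
          factor = solve-∀

  coeff-deriv : ∀ L N → coeff (deriv L) N ≡ coeff L (suc N)
  coeff-deriv []            N = refl
  coeff-deriv ((b , d) ∷ L) N = cong₂ _+_ (ℤP.*-assoc b d _) (coeff-deriv L N)

  coeff-⊗-cons : ∀ a c L M N → coeff (((a , c) ∷ L) ⊗ M) N ≡ a * coeff (shift c M) N + coeff (L ⊗ M) N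
  coeff-⊗-cons a c L M N =
    trans (coeff-++ (scale a (shift c M)) (L ⊗ M) N) (cong (_+ coeff (L ⊗ M) N) (coeff-scale a (shift c M) N))

  coeff-shift : ∀ c M N → coeff (shift c M) N ≡ sumTo N (λ q → ι (N C q) * c ^ q * coeff M (N ∸ q))
  coeff-shift c []            N = sym (trans (sumTo-cong N λ q → ℤP.*-zeroʳ (ι (N C q) * c ^ q)) (sumTo-zero N))
  coeff-shift c ((b , d) ∷ M) N = begin
    b * (c + d) ^ N + coeff (shift c M) N
      ≡⟨ cong₂ _+_ (trans (cong (b *_) (binomial c d N)) (sym (sumTo-*ˡ N b _))) (coeff-shift c M N) ⟩
    sumTo N (λ q → b * (ι (N C q) * c ^ q * d ^ (N ∸ q))) + sumTo N (λ q → ι (N C q) * c ^ q * coeff M (N ∸ q))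
      ≡⟨ sym (sumTo-+ N _ _) ⟩
    sumTo N (λ q → b * (ι (N C q) * c ^ q * d ^ (N ∸ q)) + ι (N C q) * c ^ q * coeff M (N ∸ q))
      ≡⟨ sumTo-cong N (λ q → factor b (ι (N C q) * c ^ q) (d ^ (N ∸ q)) (coeff M (N ∸ q))) ⟩
    sumTo N (λ q → ι (N C q) * c ^ q * (b * d ^ (N ∸ q) + coeff M (N ∸ q))) ∎
    where factor : ∀ b x y z → b * (x * y) + x * z ≡ x * (b * y + z)
          factor = solve-∀

  -- The operations commute with each other as lists; in particular '_⊗_' is associative and
  -- 'one' is a left unit on the nose, which keeps most algebra free of coefficient bookkeeping.
  scale-++ : ∀ a L M → scale a (L ++ M) ≡ scale a L ++ scale a M
  scale-++ a []            M = refl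
  scale-++ a ((b , d) ∷ L) M = cong ((a * b , d) ∷_) (scale-++ a L M)

  shift-++ : ∀ c L M → shift c (L ++ M) ≡ shift c L ++ shift c M
  shift-++ c []            M = refl
  shift-++ c ((b , d) ∷ L) M = cong ((b , c + d) ∷_) (shift-++ c L M)

  dilate-++ : ∀ e L M → dilate e (L ++ M) ≡ dilate e L ++ dilate e M
  dilate-++ e []            M = refl
  dilate-++ e ((b , d) ∷ L) M = cong ((b , e * d) ∷_) (dilate-++ e L M)

  scale-scale : ∀ a b L → scale a (scale b L) ≡ scale (a * b) L
  scale-scale a b []            = refl
  scale-scale a b ((c , d) ∷ L) = cong₂ (λ x → (x , d) ∷_) (sym (ℤP.*-assoc a b c)) (scale-scale a b L)

  scale-comm : ∀ a b L → scale a (scale b L) ≡ scale b (scale a L)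
  scale-comm a b L = trans (scale-scale a b L) (trans (cong (λ x → scale x L) (ℤP.*-comm a b)) (sym (scale-scale b a L)))

  shift-shift : ∀ c d L → shift c (shift d L) ≡ shift (c + d) L
  shift-shift c d []            = refl
  shift-shift c d ((b , e) ∷ L) = cong₂ (λ x → (b , x) ∷_) (sym (ℤP.+-assoc c d e)) (shift-shift c d L)

  shift-scale : ∀ c a L → shift c (scale a L) ≡ scale a (shift c L)
  shift-scale c a []            = refl
  shift-scale c a ((b , d) ∷ L) = cong ((a * b , c + d) ∷_) (shift-scale c a L)

  dilate-scale : ∀ e a L → dilate e (scale a L) ≡ scale a (dilate e L)
  dilate-scale e a []            = refl
  dilate-scale e a ((b , d) ∷ L) = cong ((a * b , e * d) ∷_) (dilate-scale e a L)

  dilate-shift : ∀ e c L → dilate e (shift c L) ≡ shift (e * c) (dilate e L)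
  dilate-shift e c []            = refl
  dilate-shift e c ((b , d) ∷ L) = cong₂ (λ x → (b , x) ∷_) (ℤP.*-distribˡ-+ e c d) (dilate-shift e c L)

  scale-identity : ∀ L → scale 1ℤ L ≡ L
  scale-identity []            = refl
  scale-identity ((b , d) ∷ L) = cong₂ (λ x → (x , d) ∷_) (ℤP.*-identityˡ b) (scale-identity L)

  shift-identity : ∀ L → shift 0ℤ L ≡ L
  shift-identity []            = refl
  shift-identity ((b , d) ∷ L) = cong₂ (λ x → (b , x) ∷_) (ℤP.+-identityˡ d) (shift-identity L)

  ++-⊗ : ∀ L L′ M → (L ++ L′) ⊗ M ≡ L ⊗ M ++ L′ ⊗ M
  ++-⊗ []            L′ M = refl
  ++-⊗ ((a , c) ∷ L) L′ M =
    trans (cong (scale a (shift c M) ++_) (++-⊗ L L′ M)) (sym (ListP.++-assoc (scale a (shift c M)) (L ⊗ M) (L′ ⊗ M)))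

  scale-⊗ : ∀ a L M → scale a L ⊗ M ≡ scale a (L ⊗ M)
  scale-⊗ a []            M = refl
  scale-⊗ a ((b , c) ∷ L) M = begin
    scale (a * b) (shift c M) ++ scale a L ⊗ M        ≡⟨ cong₂ _++_ (sym (scale-scale a b _)) (scale-⊗ a L M) ⟩
    scale a (scale b (shift c M)) ++ scale a (L ⊗ M)  ≡⟨ sym (scale-++ a _ (L ⊗ M)) ⟩
    scale a (scale b (shift c M) ++ L ⊗ M)            ∎

  shift-⊗ : ∀ c L M → shift c L ⊗ M ≡ shift c (L ⊗ M)
  shift-⊗ c []            M = refl
  shift-⊗ c ((b , d) ∷ L) M = begin
    scale b (shift (c + d) M) ++ shift c L ⊗ M          ≡⟨ cong₂ _++_ (cong (scale b) (sym (shift-shift c d M))) (shift-⊗ c L M) ⟩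
    scale b (shift c (shift d M)) ++ shift c (L ⊗ M)    ≡⟨ cong (_++ shift c (L ⊗ M)) (sym (shift-scale c b (shift d M))) ⟩
    shift c (scale b (shift d M)) ++ shift c (L ⊗ M)    ≡⟨ sym (shift-++ c _ (L ⊗ M)) ⟩
    shift c (scale b (shift d M) ++ L ⊗ M)              ∎

  ⊗-scaleʳ : ∀ a L M → L ⊗ scale a M ≡ scale a (L ⊗ M)
  ⊗-scaleʳ a []            M = refl
  ⊗-scaleʳ a ((b , c) ∷ L) M = begin
    scale b (shift c (scale a M)) ++ L ⊗ scale a M     ≡⟨ cong₂ _++_ (cong (scale b) (shift-scale c a M)) (⊗-scaleʳ a L M) ⟩
    scale b (scale a (shift c M)) ++ scale a (L ⊗ M)   ≡⟨ cong (_++ scale a (L ⊗ M)) (scale-comm b a (shift c M)) ⟩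
    scale a (scale b (shift c M)) ++ scale a (L ⊗ M)   ≡⟨ sym (scale-++ a _ (L ⊗ M)) ⟩
    scale a (scale b (shift c M) ++ L ⊗ M)             ∎

  ⊗-assoc : ∀ L M P → L ⊗ M ⊗ P ≡ L ⊗ (M ⊗ P)
  ⊗-assoc []            M P = refl
  ⊗-assoc ((a , c) ∷ L) M P = begin
    (scale a (shift c M) ++ L ⊗ M) ⊗ P         ≡⟨ ++-⊗ (scale a (shift c M)) (L ⊗ M) P ⟩
    scale a (shift c M) ⊗ P ++ L ⊗ M ⊗ P       ≡⟨ cong₂ _++_ (trans (scale-⊗ a (shift c M) P) (cong (scale a) (shift-⊗ c M P))) (⊗-assoc L M P) ⟩
    scale a (shift c (M ⊗ P)) ++ L ⊗ (M ⊗ P)   ∎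

  one-⊗ : ∀ M → one ⊗ M ≡ M
  one-⊗ M = trans (ListP.++-identityʳ _) (trans (scale-identity (shift 0ℤ M)) (shift-identity M))

  dilate-⊗ : ∀ e L M → dilate e (L ⊗ M) ≡ dilate e L ⊗ dilate e M
  dilate-⊗ e []            M = refl
  dilate-⊗ e ((a , c) ∷ L) M = begin
    dilate e (scale a (shift c M) ++ L ⊗ M)              ≡⟨ dilate-++ e (scale a (shift c M)) (L ⊗ M) ⟩
    dilate e (scale a (shift c M)) ++ dilate e (L ⊗ M)   ≡⟨ cong₂ _++_ (trans (dilate-scale e a _) (cong (scale a) (dilate-shift e c M))) (dilate-⊗ e L M) ⟩
    scale a (shift (e * c) (dilate e M)) ++ dilate e L ⊗ dilate e M ∎

  dilate-^⊗ : ∀ e A r → dilate e (A ^⊗ r) ≡ dilate e A ^⊗ r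
  dilate-^⊗ e A zero    = cong (λ x → (1ℤ , x) ∷ []) (ℤP.*-zeroʳ e)
  dilate-^⊗ e A (suc r) = trans (dilate-⊗ e A (A ^⊗ r)) (cong (dilate e A ⊗_) (dilate-^⊗ e A r))

  scale-^⊗ : ∀ a A r → scale a A ^⊗ r ≡ scale (a ^ r) (A ^⊗ r)
  scale-^⊗ a A zero    = refl
  scale-^⊗ a A (suc r) = begin
    scale a A ⊗ scale a A ^⊗ r             ≡⟨ cong (scale a A ⊗_) (scale-^⊗ a A r) ⟩
    scale a A ⊗ scale (a ^ r) (A ^⊗ r)     ≡⟨ trans (scale-⊗ a A _) (cong (scale a) (⊗-scaleʳ (a ^ r) A (A ^⊗ r))) ⟩
    scale a (scale (a ^ r) (A ⊗ A ^⊗ r))   ≡⟨ scale-scale a (a ^ r) _ ⟩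
    scale (a ^ suc r) (A ⊗ A ^⊗ r)         ∎

  -- Commutativity only holds up to '_≈_' (the terms of a product come in a different order),
  -- so congruence of the operations for '_≈_' is needed as well.
  shift-cong : ∀ c {M M′} → M ≈ M′ → shift c M ≈ shift c M′
  shift-cong c {M} {M′} M≈M′ .at N = begin
    coeff (shift c M) N                                   ≡⟨ coeff-shift c M N ⟩
    sumTo N (λ q → ι (N C q) * c ^ q * coeff M (N ∸ q))   ≡⟨ sumTo-cong N (λ q → cong (ι (N C q) * c ^ q *_) (M≈M′ .at (N ∸ q))) ⟩
    sumTo N (λ q → ι (N C q) * c ^ q * coeff M′ (N ∸ q))  ≡⟨ sym (coeff-shift c M′ N) ⟩
    coeff (shift c M′) N                                  ∎

  ⊗-congʳ : ∀ L {M M′} → M ≈ M′ → L ⊗ M ≈ L ⊗ M′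
  ⊗-congʳ []            M≈M′ .at N = refl
  ⊗-congʳ ((a , c) ∷ L) {M} {M′} M≈M′ .at N = begin
    coeff (((a , c) ∷ L) ⊗ M) N                  ≡⟨ coeff-⊗-cons a c L M N ⟩
    a * coeff (shift c M) N + coeff (L ⊗ M) N    ≡⟨ cong₂ (λ x y → a * x + y) (shift-cong c M≈M′ .at N) (⊗-congʳ L M≈M′ .at N) ⟩
    a * coeff (shift c M′) N + coeff (L ⊗ M′) N  ≡⟨ sym (coeff-⊗-cons a c L M′ N) ⟩
    coeff (((a , c) ∷ L) ⊗ M′) N                 ∎

  coeff-⊗ : ∀ L M N → coeff (L ⊗ M) N ≡ sumTo N (λ q → ι (N C q) * coeff L q * coeff M (N ∸ q))
  coeff-⊗ []            M N = sym (trans (sumTo-cong N λ q → cong (_* coeff M (N ∸ q)) (ℤP.*-zeroʳ (ι (N C q))))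
                                         (sumTo-zero N))
  coeff-⊗ ((a , c) ∷ L) M N = begin
    coeff (((a , c) ∷ L) ⊗ M) N                ≡⟨ coeff-⊗-cons a c L M N ⟩
    a * coeff (shift c M) N + coeff (L ⊗ M) N  ≡⟨ cong₂ _+_ (trans (cong (a *_) (coeff-shift c M N)) (sym (sumTo-*ˡ N a _))) (coeff-⊗ L M N) ⟩
    sumTo N (λ q → a * (ι (N C q) * c ^ q * coeff M (N ∸ q))) + sumTo N (λ q → ι (N C q) * coeff L q * coeff M (N ∸ q))
      ≡⟨ sym (sumTo-+ N _ _) ⟩
    sumTo N (λ q → a * (ι (N C q) * c ^ q * coeff M (N ∸ q)) + ι (N C q) * coeff L q * coeff M (N ∸ q))
      ≡⟨ sumTo-cong N (λ q → factor a (ι (N C q)) (c ^ q) (coeff L q) (coeff M (N ∸ q))) ⟩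
    sumTo N (λ q → ι (N C q) * (a * c ^ q + coeff L q) * coeff M (N ∸ q)) ∎
    where factor : ∀ a x y z w → a * (x * y * w) + x * z * w ≡ x * (a * y + z) * w
          factor = solve-∀

  ⊗-zeroʳ : ∀ L → L ⊗ [] ≡ []
  ⊗-zeroʳ []            = refl
  ⊗-zeroʳ ((a , c) ∷ L) = ⊗-zeroʳ L

  coeff-⊗-consʳ : ∀ L b d M N → coeff (L ⊗ ((b , d) ∷ M)) N ≡ b * coeff (shift d L) N + coeff (L ⊗ M) N
  coeff-⊗-consʳ []            b d M N = sym (trans (ℤP.+-identityʳ (b * 0ℤ)) (ℤP.*-zeroʳ b))
  coeff-⊗-consʳ ((a , c) ∷ L) b d M N = begin
    coeff (((a , c) ∷ L) ⊗ ((b , d) ∷ M)) N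
      ≡⟨ coeff-⊗-cons a c L ((b , d) ∷ M) N ⟩
    a * (b * (c + d) ^ N + coeff (shift c M) N) + coeff (L ⊗ ((b , d) ∷ M)) N
      ≡⟨ cong₂ (λ x y → a * (b * x ^ N + coeff (shift c M) N) + y) (ℤP.+-comm c d) (coeff-⊗-consʳ L b d M N) ⟩
    a * (b * (d + c) ^ N + coeff (shift c M) N) + (b * coeff (shift d L) N + coeff (L ⊗ M) N)
      ≡⟨ rearrange a b ((d + c) ^ N) (coeff (shift c M) N) (coeff (shift d L) N) (coeff (L ⊗ M) N) ⟩
    b * (a * (d + c) ^ N + coeff (shift d L) N) + (a * coeff (shift c M) N + coeff (L ⊗ M) N)
      ≡⟨ cong (b * (a * (d + c) ^ N + coeff (shift d L) N) +_) (sym (coeff-⊗-cons a c L M N)) ⟩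
    b * coeff (shift d ((a , c) ∷ L)) N + coeff (((a , c) ∷ L) ⊗ M) N ∎
    where rearrange : ∀ a b p x y z → a * (b * p + x) + (b * y + z) ≡ b * (a * p + y) + (a * x + z)
          rearrange = solve-∀

  ⊗-comm : ∀ L M → L ⊗ M ≈ M ⊗ L
  ⊗-comm L []            .at N = cong (λ X → coeff X N) (⊗-zeroʳ L)
  ⊗-comm L ((b , d) ∷ M) .at N = begin
    coeff (L ⊗ ((b , d) ∷ M)) N                ≡⟨ coeff-⊗-consʳ L b d M N ⟩
    b * coeff (shift d L) N + coeff (L ⊗ M) N  ≡⟨ cong (b * coeff (shift d L) N +_) (⊗-comm L M .at N) ⟩
    b * coeff (shift d L) N + coeff (M ⊗ L) N  ≡⟨ sym (coeff-⊗-cons b d M L N) ⟩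
    coeff (((b , d) ∷ M) ⊗ L) N                ∎

  ⊗-congˡ : ∀ {L L′} M → L ≈ L′ → L ⊗ M ≈ L′ ⊗ M
  ⊗-congˡ {L} {L′} M L≈L′ = ≈-trans (⊗-comm L M) (≈-trans (⊗-congʳ M L≈L′) (⊗-comm M L′))

  ⊗-cong : ∀ {L L′ M M′} → L ≈ L′ → M ≈ M′ → L ⊗ M ≈ L′ ⊗ M′
  ⊗-cong {L′ = L′} {M = M} L≈L′ M≈M′ = ≈-trans (⊗-congˡ M L≈L′) (⊗-congʳ L′ M≈M′)

  ^⊗-cong : ∀ {A A′} r → A ≈ A′ → A ^⊗ r ≈ A′ ^⊗ r
  ^⊗-cong zero    A≈A′ = ≡⇒≈ refl
  ^⊗-cong (suc r) A≈A′ = ⊗-cong A≈A′ (^⊗-cong r A≈A′)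

  ^⊗-+ : ∀ A a b → A ^⊗ (a ℕ.+ b) ≡ A ^⊗ a ⊗ A ^⊗ b
  ^⊗-+ A zero    b = sym (one-⊗ (A ^⊗ b))
  ^⊗-+ A (suc a) b = trans (cong (A ⊗_) (^⊗-+ A a b)) (sym (⊗-assoc A (A ^⊗ a) (A ^⊗ b)))

  ⊗-left-comm : ∀ L M P → L ⊗ (M ⊗ P) ≈ M ⊗ (L ⊗ P)
  ⊗-left-comm L M P .at N = begin
    coeff (L ⊗ (M ⊗ P)) N  ≡⟨ cong (λ X → coeff X N) (sym (⊗-assoc L M P)) ⟩
    coeff (L ⊗ M ⊗ P) N    ≡⟨ ⊗-congˡ P (⊗-comm L M) .at N ⟩
    coeff (M ⊗ L ⊗ P) N    ≡⟨ cong (λ X → coeff X N) (⊗-assoc M L P) ⟩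
    coeff (M ⊗ (L ⊗ P)) N  ∎

  ⊗-interchange : ∀ A P B Q → A ⊗ P ⊗ (B ⊗ Q) ≈ A ⊗ B ⊗ (P ⊗ Q)
  ⊗-interchange A P B Q .at N = begin
    coeff (A ⊗ P ⊗ (B ⊗ Q)) N    ≡⟨ cong (λ X → coeff X N) (⊗-assoc A P (B ⊗ Q)) ⟩
    coeff (A ⊗ (P ⊗ (B ⊗ Q))) N  ≡⟨ ⊗-congʳ A (⊗-left-comm P B Q) .at N ⟩
    coeff (A ⊗ (B ⊗ (P ⊗ Q))) N  ≡⟨ cong (λ X → coeff X N) (sym (⊗-assoc A B (P ⊗ Q))) ⟩
    coeff (A ⊗ B ⊗ (P ⊗ Q)) N    ∎

  ^⊗-distrib-⊗ : ∀ A B r → A ^⊗ r ⊗ B ^⊗ r ≈ (A ⊗ B) ^⊗ r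
  ^⊗-distrib-⊗ A B zero    = ≡⇒≈ (one-⊗ one)
  ^⊗-distrib-⊗ A B (suc r) = ≈-trans (⊗-interchange A (A ^⊗ r) B (B ^⊗ r)) (⊗-congʳ (A ⊗ B) (^⊗-distrib-⊗ A B r))

  coeff-shift-suc : ∀ c M N → coeff (shift c M) (suc N) ≡ c * coeff (shift c M) N + coeff (shift c (deriv M)) N
  coeff-shift-suc c []            N = sym (trans (ℤP.+-identityʳ (c * 0ℤ)) (ℤP.*-zeroʳ c))
  coeff-shift-suc c ((b , d) ∷ M) N =
    trans (cong (b * ((c + d) * (c + d) ^ N) +_) (coeff-shift-suc c M N))
          (rearrange b c d ((c + d) ^ N) (coeff (shift c M) N) (coeff (shift c (deriv M)) N))
    where rearrange : ∀ b c d p x y → b * ((c + d) * p) + (c * x + y) ≡ c * (b * p + x) + (b * d * p + y)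
          rearrange = solve-∀

  leibniz : ∀ L M N → coeff (L ⊗ M) (suc N) ≡ coeff (deriv L ⊗ M) N + coeff (L ⊗ deriv M) N
  leibniz []            M N = refl
  leibniz ((a , c) ∷ L) M N = begin
    coeff (((a , c) ∷ L) ⊗ M) (suc N)
      ≡⟨ coeff-⊗-cons a c L M (suc N) ⟩
    a * coeff (shift c M) (suc N) + coeff (L ⊗ M) (suc N)
      ≡⟨ cong₂ _+_ (cong (a *_) (coeff-shift-suc c M N)) (leibniz L M N) ⟩
    a * (c * S + S′) + (coeff (deriv L ⊗ M) N + coeff (L ⊗ deriv M) N)
      ≡⟨ rearrange a c S S′ (coeff (deriv L ⊗ M) N) (coeff (L ⊗ deriv M) N) ⟩
    (a * c * S + coeff (deriv L ⊗ M) N) + (a * S′ + coeff (L ⊗ deriv M) N)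
      ≡⟨ sym (cong₂ _+_ (coeff-⊗-cons (a * c) c (deriv L) M N) (coeff-⊗-cons a c L (deriv M) N)) ⟩
    coeff (deriv ((a , c) ∷ L) ⊗ M) N + coeff (((a , c) ∷ L) ⊗ deriv M) N ∎
    where
    S S′ : ℤ
    S  = coeff (shift c M) N
    S′ = coeff (shift c (deriv M)) N
    rearrange : ∀ a c s s′ u v → a * (c * s + s′) + (u + v) ≡ (a * c * s + u) + (a * s′ + v)
    rearrange = solve-∀

  power-rule : ∀ A j N → coeff (A ^⊗ suc j) (suc N) ≡ ι (suc j) * coeff (deriv A ⊗ A ^⊗ j) N
  power-rule A zero N = begin
    coeff (A ⊗ one) (suc N)                             ≡⟨ leibniz A one N ⟩
    coeff (deriv A ⊗ one) N + coeff (A ⊗ deriv one) N   ≡⟨ cong (coeff (deriv A ⊗ one) N +_) A⊗deriv-one≡0 ⟩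
    coeff (deriv A ⊗ one) N + 0ℤ                        ≡⟨ trans (ℤP.+-identityʳ _) (sym (ℤP.*-identityˡ _)) ⟩
    1ℤ * coeff (deriv A ⊗ one) N                        ∎
    where
    A⊗deriv-one≡0 : coeff (A ⊗ deriv one) N ≡ 0ℤ
    A⊗deriv-one≡0 = trans (coeff-⊗-consʳ A 0ℤ 0ℤ [] N) (cong (λ X → 0ℤ * coeff (shift 0ℤ A) N + coeff X N) (⊗-zeroʳ A))
  power-rule A (suc j) N = begin
    coeff (A ⊗ A ^⊗ suc j) (suc N)                              ≡⟨ leibniz A (A ^⊗ suc j) N ⟩
    coeff (deriv A ⊗ A ^⊗ suc j) N + coeff (A ⊗ deriv (A ^⊗ suc j)) N
      ≡⟨ cong (coeff (deriv A ⊗ A ^⊗ suc j) N +_) second-term ⟩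
    coeff (deriv A ⊗ A ^⊗ suc j) N + K * coeff (deriv A ⊗ A ^⊗ suc j) N
      ≡⟨ sym (trans (cong (_* coeff (deriv A ⊗ A ^⊗ suc j) N) (ℤP.pos-+ 1 (suc j))) (factor K _)) ⟩
    ι (suc (suc j)) * coeff (deriv A ⊗ A ^⊗ suc j) N            ∎
    where
    K : ℤ
    K = ι (suc j)
    factor : ∀ k x → (1ℤ + k) * x ≡ x + k * x
    factor = solve-∀
    deriv-power : deriv (A ^⊗ suc j) ≈ scale K (deriv A ⊗ A ^⊗ j)
    deriv-power .at N′ =
      trans (coeff-deriv (A ^⊗ suc j) N′) (trans (power-rule A j N′) (sym (coeff-scale K (deriv A ⊗ A ^⊗ j) N′)))
    second-term : coeff (A ⊗ deriv (A ^⊗ suc j)) N ≡ K * coeff (deriv A ⊗ A ^⊗ suc j) N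
    second-term = begin
      coeff (A ⊗ deriv (A ^⊗ suc j)) N            ≡⟨ ⊗-congʳ A deriv-power .at N ⟩
      coeff (A ⊗ scale K (deriv A ⊗ A ^⊗ j)) N    ≡⟨ cong (λ X → coeff X N) (⊗-scaleʳ K A _) ⟩
      coeff (scale K (A ⊗ (deriv A ⊗ A ^⊗ j))) N  ≡⟨ coeff-scale K (A ⊗ (deriv A ⊗ A ^⊗ j)) N ⟩
      K * coeff (A ⊗ (deriv A ⊗ A ^⊗ j)) N        ≡⟨ cong (K *_) (⊗-left-comm A (deriv A) (A ^⊗ j) .at N) ⟩
      K * coeff (deriv A ⊗ A ^⊗ suc j) N          ∎

  expm1 : ExpPoly
  expm1 = (1ℤ , 1ℤ) ∷ (-1ℤ , 0ℤ) ∷ []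

  coeff-expm1-⊗ : ∀ M N → coeff (expm1 ⊗ M) N ≡ coeff (shift 1ℤ M) N - coeff M N
  coeff-expm1-⊗ M N = begin
    coeff (expm1 ⊗ M) N   ≡⟨ coeff-⊗-cons 1ℤ 1ℤ ((-1ℤ , 0ℤ) ∷ []) M N ⟩
    1ℤ * S + coeff (((-1ℤ , 0ℤ) ∷ []) ⊗ M) N  ≡⟨ cong (1ℤ * S +_) (coeff-⊗-cons -1ℤ 0ℤ [] M N) ⟩
    1ℤ * S + (-1ℤ * coeff (shift 0ℤ M) N + 0ℤ) ≡⟨ cong (λ X → 1ℤ * S + (-1ℤ * coeff X N + 0ℤ)) (shift-identity M) ⟩
    1ℤ * S + (-1ℤ * coeff M N + 0ℤ)            ≡⟨ simplify S (coeff M N) ⟩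
    S - coeff M N                              ∎
    where
    S : ℤ
    S = coeff (shift 1ℤ M) N
    simplify : ∀ s m → 1ℤ * s + (-1ℤ * m + 0ℤ) ≡ s - m
    simplify = solve-∀

  coeff-deriv-expm1-⊗ : ∀ M N → coeff (deriv expm1 ⊗ M) N ≡ coeff (expm1 ⊗ M) N + coeff M N
  coeff-deriv-expm1-⊗ M N = begin
    coeff (deriv expm1 ⊗ M) N     ≡⟨ coeff-⊗-cons 1ℤ 1ℤ ((0ℤ , 0ℤ) ∷ []) M N ⟩
    1ℤ * S + coeff (((0ℤ , 0ℤ) ∷ []) ⊗ M) N  ≡⟨ cong (1ℤ * S +_) (coeff-⊗-cons 0ℤ 0ℤ [] M N) ⟩
    1ℤ * S + (0ℤ * coeff (shift 0ℤ M) N + 0ℤ) ≡⟨ simplify S (coeff M N) ⟩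
    (S - coeff M N) + coeff M N                ≡⟨ cong (_+ coeff M N) (sym (coeff-expm1-⊗ M N)) ⟩
    coeff (expm1 ⊗ M) N + coeff M N            ∎
    where
    S : ℤ
    S = coeff (shift 1ℤ M) N
    simplify : ∀ s m → 1ℤ * s + 0ℤ ≡ (s - m) + m
    simplify = solve-∀

  -- The defining property of the Stirling numbers:  (e^t − 1)^k = k! Σ_N S(N,k) t^N/N!.  By the
  -- power rule the coefficients satisfy the recurrence defining 'stirling2'.
  coeff-expm1^⊗ : ∀ N k → coeff (expm1 ^⊗ k) N ≡ ι (k ! ℕ.* stirling2 N k)
  coeff-expm1^⊗ zero    zero    = refl
  coeff-expm1^⊗ zero    (suc k) = trans (coeff-⊗ expm1 (expm1 ^⊗ k) 0) (cong ι (sym (ℕP.*-zeroʳ (suc k !))))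
  coeff-expm1^⊗ (suc N) zero    = refl
  coeff-expm1^⊗ (suc N) (suc k) = begin
    coeff (expm1 ^⊗ suc k) (suc N)                              ≡⟨ power-rule expm1 k N ⟩
    ι (suc k) * coeff (deriv expm1 ⊗ expm1 ^⊗ k) N              ≡⟨ cong (ι (suc k) *_) (coeff-deriv-expm1-⊗ (expm1 ^⊗ k) N) ⟩
    ι (suc k) * (coeff (expm1 ^⊗ suc k) N + coeff (expm1 ^⊗ k) N)
      ≡⟨ cong₂ (λ x y → ι (suc k) * (x + y)) (coeff-expm1^⊗ N (suc k)) (coeff-expm1^⊗ N k) ⟩
    ι (suc k) * (ι A + ι B)      ≡⟨ sym (trans (ℤP.pos-* (suc k) (A ℕ.+ B)) (cong (ι (suc k) *_) (ℤP.pos-+ A B))) ⟩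
    ι (suc k ℕ.* (A ℕ.+ B))      ≡⟨ cong ι (regroup k (k !) (stirling2 N (suc k)) (stirling2 N k)) ⟩
    ι (suc k ! ℕ.* stirling2 (suc N) (suc k)) ∎
    where
    A B : ℕ
    A = suc k ! ℕ.* stirling2 N (suc k)
    B = k ! ℕ.* stirling2 N k
    regroup : ∀ k f a b → suc k ℕ.* (suc k ℕ.* f ℕ.* a ℕ.+ f ℕ.* b) ≡ suc k ℕ.* f ℕ.* (suc k ℕ.* a ℕ.+ b)
    regroup = ℕSolver.solve-∀

  sgn≡-1^ : ∀ r → -1ℤ ^ r ≡ sgn r
  sgn≡-1^ zero    = refl
  sgn≡-1^ (suc r) = trans (cong (-1ℤ *_) (sgn≡-1^ r)) (-1*x≡-x (sgn r))
    where -1*x≡-x : ∀ x → -1ℤ * x ≡ - x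
          -1*x≡-x = solve-∀

  sgn-cancel : ∀ r i → sgn r * sgn (r ℕ.+ i) ≡ sgn i
  sgn-cancel zero    i = ℤP.*-identityˡ (sgn i)
  sgn-cancel (suc r) i = trans (neg*neg (sgn r) (sgn (r ℕ.+ i))) (sgn-cancel r i)
    where neg*neg : ∀ x y → - x * - y ≡ x * y
          neg*neg = solve-∀

  neg-pow : ∀ c q → (- ι c) ^ q ≡ sgn q * ι (c ℕ.^ q)
  neg-pow c zero    = refl
  neg-pow c (suc q) = begin
    - ι c * (- ι c) ^ q            ≡⟨ cong (- ι c *_) (neg-pow c q) ⟩
    - ι c * (sgn q * ι (c ℕ.^ q))  ≡⟨ rearrange (ι c) (sgn q) (ι (c ℕ.^ q)) ⟩
    - sgn q * (ι c * ι (c ℕ.^ q))  ≡⟨ cong (- sgn q *_) (sym (ℤP.pos-* c (c ℕ.^ q))) ⟩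
    - sgn q * ι (c ℕ.* c ℕ.^ q)    ∎
    where rearrange : ∀ x s y → - x * (s * y) ≡ - s * (x * y)
          rearrange = solve-∀

  -- S(a,b) = 0 for a < b; this makes the sums in the theorem finite.
  stirling2-vanishes : ∀ a b → a < b → stirling2 a b ≡ 0
  stirling2-vanishes zero    (suc b) _         = refl
  stirling2-vanishes (suc a) (suc b) (s≤s a<b)
    rewrite stirling2-vanishes a (suc b) (ℕP.m<n⇒m<1+n a<b) | stirling2-vanishes a b a<b =
      trans (ℕP.+-identityʳ (b ℕ.* 0)) (ℕP.*-zeroʳ b)

  -- Y = Σ_{p=1}^{n} e^{−pt}.  The negative frequencies produce the signs (−1)^q of the theorem.
  negExpSum : ℕ → ExpPoly
  negExpSum zero    = []
  negExpSum (suc n) = negExpSum n ++ (1ℤ , - ι (suc n)) ∷ []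

  coeff-negExpSum-⊗ : ∀ c m M q (f : ℕ → ℕ) → (∀ p → coeff (shift (- ι (c ℕ.+ p)) M) q ≡ sgn q * ι (f p)) →
    coeff (shift (- ι c) (negExpSum m) ⊗ M) q ≡ sgn q * ι (sum1 m f)
  coeff-negExpSum-⊗ c zero    M q f shift-coeff = sym (ℤP.*-zeroʳ (sgn q))
  coeff-negExpSum-⊗ c (suc m) M q f shift-coeff = begin
    coeff (shift (- ι c) (negExpSum m ++ term) ⊗ M) q
      ≡⟨ cong (λ L → coeff (L ⊗ M) q) (shift-++ (- ι c) (negExpSum m) term) ⟩
    coeff ((shift (- ι c) (negExpSum m) ++ shift (- ι c) term) ⊗ M) q
      ≡⟨ cong (λ L → coeff L q) (++-⊗ (shift (- ι c) (negExpSum m)) (shift (- ι c) term) M) ⟩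
    coeff (shift (- ι c) (negExpSum m) ⊗ M ++ shift (- ι c) term ⊗ M) q
      ≡⟨ coeff-++ (shift (- ι c) (negExpSum m) ⊗ M) (shift (- ι c) term ⊗ M) q ⟩
    coeff (shift (- ι c) (negExpSum m) ⊗ M) q + coeff (shift (- ι c) term ⊗ M) q
      ≡⟨ cong₂ _+_ (coeff-negExpSum-⊗ c m M q f shift-coeff) last-term ⟩
    sgn q * ι (sum1 m f) + sgn q * ι (f (suc m))
      ≡⟨ sym (trans (cong (sgn q *_) (ℤP.pos-+ (sum1 m f) (f (suc m)))) (ℤP.*-distribˡ-+ (sgn q) _ _)) ⟩
    sgn q * ι (sum1 (suc m) f) ∎
    where
    term : ExpPoly
    term = (1ℤ , - ι (suc m)) ∷ []
    frequency : - ι c + - ι (suc m) ≡ - ι (c ℕ.+ suc m)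
    frequency = trans (sym (ℤP.neg-distrib-+ (ι c) (ι (suc m)))) (cong -_ (sym (ℤP.pos-+ c (suc m))))
    last-term : coeff (shift (- ι c) term ⊗ M) q ≡ sgn q * ι (f (suc m))
    last-term = begin
      coeff (shift (- ι c) term ⊗ M) q                            ≡⟨ coeff-⊗-cons 1ℤ _ [] M q ⟩
      1ℤ * coeff (shift (- ι c + - ι (suc m)) M) q + 0ℤ           ≡⟨ trans (ℤP.+-identityʳ _) (ℤP.*-identityˡ _) ⟩
      coeff (shift (- ι c + - ι (suc m)) M) q                     ≡⟨ cong (λ d → coeff (shift d M) q) frequency ⟩
      coeff (shift (- ι (c ℕ.+ suc m)) M) q                       ≡⟨ shift-coeff (suc m) ⟩
      sgn q * ι (f (suc m))                                       ∎

  coeff-shift-negExpSum^⊗ : ∀ n r c q → coeff (shift (- ι c) (negExpSum n ^⊗ r)) q ≡ sgn q * ι (tupleSum r n c q)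
  coeff-shift-negExpSum^⊗ n zero    c q = begin
    1ℤ * (- ι c + 0ℤ) ^ q + 0ℤ  ≡⟨ trans (ℤP.+-identityʳ _) (ℤP.*-identityˡ _) ⟩
    (- ι c + 0ℤ) ^ q            ≡⟨ cong (_^ q) (ℤP.+-identityʳ (- ι c)) ⟩
    (- ι c) ^ q                 ≡⟨ neg-pow c q ⟩
    sgn q * ι (c ℕ.^ q)         ∎
  coeff-shift-negExpSum^⊗ n (suc r) c q =
    trans (cong (λ L → coeff L q) (sym (shift-⊗ (- ι c) (negExpSum n) (negExpSum n ^⊗ r))))
          (coeff-negExpSum-⊗ c n (negExpSum n ^⊗ r) q _ λ p → coeff-shift-negExpSum^⊗ n r (c ℕ.+ p) q)

  coeff-negExpSum^⊗ : ∀ n r q → coeff (negExpSum n ^⊗ r) q ≡ sgn q * ι (powerSum r q n)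
  coeff-negExpSum^⊗ n r q =
    trans (cong (λ L → coeff L q) (sym (shift-identity (negExpSum n ^⊗ r)))) (coeff-shift-negExpSum^⊗ n r 0 q)

  oneMinusExp : ℕ → ExpPoly
  oneMinusExp n = (1ℤ , 0ℤ) ∷ (-1ℤ , - ι n) ∷ []

  negExpSum-telescopes : ∀ n → negExpSum n ⊗ expm1 ≈ oneMinusExp n
  negExpSum-telescopes zero    .at N = sym (cancel (0ℤ ^ N))
    where cancel : ∀ x → 1ℤ * x + (-1ℤ * x + 0ℤ) ≡ 0ℤ
          cancel = solve-∀
  negExpSum-telescopes (suc n) .at N = begin
    coeff ((negExpSum n ++ term) ⊗ expm1) N
      ≡⟨ trans (cong (λ L → coeff L N) (++-⊗ (negExpSum n) term expm1)) (coeff-++ (negExpSum n ⊗ expm1) (term ⊗ expm1) N) ⟩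
    coeff (negExpSum n ⊗ expm1) N + coeff (term ⊗ expm1) N
      ≡⟨ cong₂ _+_ (negExpSum-telescopes n .at N) (coeff-⊗-cons 1ℤ c [] expm1 N) ⟩
    coeff (oneMinusExp n) N + (1ℤ * (1ℤ * (c + 1ℤ) ^ N + (-1ℤ * (c + 0ℤ) ^ N + 0ℤ)) + 0ℤ)
      ≡⟨ cong₂ (λ x y → coeff (oneMinusExp n) N + (1ℤ * (1ℤ * x ^ N + (-1ℤ * y ^ N + 0ℤ)) + 0ℤ)) (c+1 n) (ℤP.+-identityʳ c) ⟩
    coeff (oneMinusExp n) N + (1ℤ * (1ℤ * (- ι n) ^ N + (-1ℤ * c ^ N + 0ℤ)) + 0ℤ)
      ≡⟨ cancel (0ℤ ^ N) ((- ι n) ^ N) (c ^ N) ⟩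
    coeff (oneMinusExp (suc n)) N ∎
    where
    c : ℤ
    c = - ι (suc n)
    term : ExpPoly
    term = (1ℤ , c) ∷ []
    c+1 : ∀ n → - ι (suc n) + 1ℤ ≡ - ι n
    c+1 zero    = refl
    c+1 (suc n) = refl
    cancel : ∀ z a b → 1ℤ * z + (-1ℤ * a + 0ℤ) + (1ℤ * (1ℤ * a + (-1ℤ * b + 0ℤ)) + 0ℤ) ≡ 1ℤ * z + (-1ℤ * b + 0ℤ)
    cancel = solve-∀

  oneMinusExp-dilates : ∀ n → oneMinusExp n ≈ scale -1ℤ (dilate (- ι n) expm1)
  oneMinusExp-dilates n .at N rewrite ℤP.*-identityʳ (- ι n) | ℤP.*-zeroʳ (- ι n) = swap ((- ι n) ^ N) (0ℤ ^ N)
    where swap : ∀ a z → 1ℤ * z + (-1ℤ * a + 0ℤ) ≡ -1ℤ * a + (1ℤ * z + 0ℤ)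
          swap = solve-∀

  coeff-oneMinusExp^⊗ : ∀ n r a → coeff (oneMinusExp n ^⊗ r) a ≡ sgn r * ((- ι n) ^ a * ι (r ! ℕ.* stirling2 a r))
  coeff-oneMinusExp^⊗ n r a = begin
    coeff (oneMinusExp n ^⊗ r) a                        ≡⟨ ^⊗-cong r (oneMinusExp-dilates n) .at a ⟩
    coeff (scale -1ℤ (dilate e expm1) ^⊗ r) a           ≡⟨ cong (λ L → coeff L a) (scale-^⊗ -1ℤ (dilate e expm1) r) ⟩
    coeff (scale (-1ℤ ^ r) (dilate e expm1 ^⊗ r)) a     ≡⟨ coeff-scale (-1ℤ ^ r) (dilate e expm1 ^⊗ r) a ⟩
    -1ℤ ^ r * coeff (dilate e expm1 ^⊗ r) a             ≡⟨ cong₂ _*_ (sgn≡-1^ r) (cong (λ L → coeff L a) (sym (dilate-^⊗ e expm1 r))) ⟩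
    sgn r * coeff (dilate e (expm1 ^⊗ r)) a             ≡⟨ cong (sgn r *_) (coeff-dilate e (expm1 ^⊗ r) a) ⟩
    sgn r * (e ^ a * coeff (expm1 ^⊗ r) a)              ≡⟨ cong (λ x → sgn r * (e ^ a * x)) (coeff-expm1^⊗ a r) ⟩
    sgn r * (e ^ a * ι (r ! ℕ.* stirling2 a r))         ∎
    where
    e : ℤ
    e = - ι n

  coeff-expm1^⊗-vanishes : ∀ a k → a < k → coeff (expm1 ^⊗ k) a ≡ 0ℤ
  coeff-expm1^⊗-vanishes a k a<k =
    trans (coeff-expm1^⊗ a k) (cong ι (trans (cong (k ! ℕ.*_) (stirling2-vanishes a k a<k)) (ℕP.*-zeroʳ (k !))))

  coeff-oneMinusExp^⊗-vanishes : ∀ n r a → a < r → coeff (oneMinusExp n ^⊗ r) a ≡ 0ℤ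
  coeff-oneMinusExp^⊗-vanishes n r a a<r = begin
    coeff (oneMinusExp n ^⊗ r) a                               ≡⟨ coeff-oneMinusExp^⊗ n r a ⟩
    sgn r * ((- ι n) ^ a * ι (r ! ℕ.* stirling2 a r))          ≡⟨ cong (λ s → sgn r * ((- ι n) ^ a * ι (r ! ℕ.* s))) (stirling2-vanishes a r a<r) ⟩
    sgn r * ((- ι n) ^ a * ι (r ! ℕ.* 0))                      ≡⟨ cong (λ x → sgn r * ((- ι n) ^ a * ι x)) (ℕP.*-zeroʳ (r !)) ⟩
    sgn r * ((- ι n) ^ a * 0ℤ)                                 ≡⟨ trans (cong (sgn r *_) (ℤP.*-zeroʳ ((- ι n) ^ a))) (ℤP.*-zeroʳ (sgn r)) ⟩
    0ℤ ∎

  coeff-oneMinusExp^⊗-from : ∀ n r i →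
    coeff (oneMinusExp n ^⊗ r) (r ℕ.+ i) ≡ sgn i * ι (r ! ℕ.* stirling2 (r ℕ.+ i) r ℕ.* n ℕ.^ (r ℕ.+ i))
  coeff-oneMinusExp^⊗-from n r i = begin
    coeff (oneMinusExp n ^⊗ r) a                 ≡⟨ coeff-oneMinusExp^⊗ n r a ⟩
    sgn r * ((- ι n) ^ a * ι Q)                  ≡⟨ cong (λ x → sgn r * (x * ι Q)) (neg-pow n a) ⟩
    sgn r * (sgn a * ι (n ℕ.^ a) * ι Q)          ≡⟨ rearrange (sgn r) (sgn a) (ι (n ℕ.^ a)) (ι Q) ⟩
    sgn r * sgn a * (ι Q * ι (n ℕ.^ a))          ≡⟨ cong₂ _*_ (sgn-cancel r i) (sym (ℤP.pos-* Q (n ℕ.^ a))) ⟩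
    sgn i * ι (Q ℕ.* n ℕ.^ a)                    ∎
    where
    a Q : ℕ
    a = r ℕ.+ i
    Q = r ! ℕ.* stirling2 a r
    rearrange : ∀ s t p q → s * (t * p * q) ≡ s * t * (q * p)
    rearrange = solve-∀

  -- If a < q ≤ a + b then a + b − q < b: beyond index a the Stirling factor S(a + b − q, b) vanishes.
  ∸-<-lower : ∀ a b q → a < q → q ≤ a ℕ.+ b → a ℕ.+ b ∸ q < b
  ∸-<-lower zero    (suc b) (suc q) _          (s≤s q≤b)   = s≤s (ℕP.m∸n≤m b q)
  ∸-<-lower (suc a) b       (suc q) (s≤s a<q) (s≤s q≤a+b) = ∸-<-lower a b q a<q q≤a+b

  lhs-sum rhs-sum : (n m k r : ℕ) → ℤ
  lhs-sum n m k r = sumTo m (λ q → sgn q * ι ((m ℕ.+ k) C q) * ι (stirling2 (m ℕ.+ k ∸ q) k) * ι (powerSum r q n))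
  rhs-sum n m k r = sumTo m (λ j → sgn j * ι ((m ℕ.+ k) C (m ℕ.+ k ∸ r ∸ j)) * ι (stirling2 (m ℕ.+ k ∸ r ∸ j) (k ∸ r))
                                   * ι (stirling2 (r ℕ.+ j) r) * ι (n ℕ.^ (r ℕ.+ j)))

  -- k! times the left-hand side is the (m+k)-th coefficient of Y^r (e^t − 1)^k: expand the
  -- convolution; the terms with q > m vanish since then m + k − q < k.
  lhs-coefficient : ∀ n m k r → ι (k !) * lhs-sum n m k r ≡ coeff (negExpSum n ^⊗ r ⊗ expm1 ^⊗ k) (m ℕ.+ k)
  lhs-coefficient n m k r = begin
    ι (k !) * sumTo m f                ≡⟨ sym (sumTo-*ˡ m (ι (k !)) f) ⟩
    sumTo m (λ q → ι (k !) * f q)      ≡⟨ sumTo-cong m term ⟩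
    sumTo m F                          ≡⟨ sym (sumTo-vanishing-tail m k F beyond-m) ⟩
    sumTo N F                          ≡⟨ sym (coeff-⊗ (negExpSum n ^⊗ r) (expm1 ^⊗ k) N) ⟩
    coeff (negExpSum n ^⊗ r ⊗ expm1 ^⊗ k) N ∎
    where
    N : ℕ
    N = m ℕ.+ k
    f F : ℕ → ℤ
    f q = sgn q * ι (N C q) * ι (stirling2 (N ∸ q) k) * ι (powerSum r q n)
    F q = ι (N C q) * coeff (negExpSum n ^⊗ r) q * coeff (expm1 ^⊗ k) (N ∸ q)
    rearrange : ∀ f s c t p → f * (s * c * t * p) ≡ c * (s * p) * (f * t)
    rearrange = solve-∀
    term : ∀ q → ι (k !) * f q ≡ F q
    term q = begin
      ι (k !) * f q
        ≡⟨ rearrange (ι (k !)) (sgn q) (ι (N C q)) (ι (stirling2 (N ∸ q) k)) (ι (powerSum r q n)) ⟩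
      ι (N C q) * (sgn q * ι (powerSum r q n)) * (ι (k !) * ι (stirling2 (N ∸ q) k))
        ≡⟨ cong₂ (λ x y → ι (N C q) * x * y) (sym (coeff-negExpSum^⊗ n r q))
                 (trans (sym (ℤP.pos-* (k !) _)) (sym (coeff-expm1^⊗ (N ∸ q) k))) ⟩
      F q ∎
    beyond-m : ∀ q → m < q → q ≤ N → F q ≡ 0ℤ
    beyond-m q m<q q≤N = trans (cong (ι (N C q) * coeff (negExpSum n ^⊗ r) q *_)
                                     (coeff-expm1^⊗-vanishes (N ∸ q) k (∸-<-lower m k q m<q q≤N)))
                               (ℤP.*-zeroʳ (ι (N C q) * coeff (negExpSum n ^⊗ r) q))

  rhs-summand : ∀ n N r j i → r ℕ.+ i ≤ N →
    ι (r ! ℕ.* j !) * (sgn i * ι (N C (N ∸ r ∸ i)) * ι (stirling2 (N ∸ r ∸ i) j)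
                       * ι (stirling2 (r ℕ.+ i) r) * ι (n ℕ.^ (r ℕ.+ i)))
      ≡ ι (N C (r ℕ.+ i)) * coeff (oneMinusExp n ^⊗ r) (r ℕ.+ i) * coeff (expm1 ^⊗ j) (N ∸ (r ℕ.+ i))
  rhs-summand n N r j i a≤N = begin
    ι (r ! ℕ.* j !) * (sgn i * ι (N C (N ∸ r ∸ i)) * ι (stirling2 (N ∸ r ∸ i) j) * ι S₂ * ι P)
      ≡⟨ cong (λ t → ι (r ! ℕ.* j !) * (sgn i * ι (N C t) * ι (stirling2 t j) * ι S₂ * ι P)) (ℕP.∸-+-assoc N r i) ⟩
    ι (r ! ℕ.* j !) * (sgn i * ι (N C (N ∸ a)) * ι S₁ * ι S₂ * ι P)
      ≡⟨ cong (λ c → ι (r ! ℕ.* j !) * (sgn i * ι c * ι S₁ * ι S₂ * ι P)) (sym (nCk≡nC[n∸k] a≤N)) ⟩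
    ι (r ! ℕ.* j !) * (sgn i * ι (N C a) * ι S₁ * ι S₂ * ι P)
      ≡⟨ cong (_* (sgn i * ι (N C a) * ι S₁ * ι S₂ * ι P)) (ℤP.pos-* (r !) (j !)) ⟩
    ι (r !) * ι (j !) * (sgn i * ι (N C a) * ι S₁ * ι S₂ * ι P)
      ≡⟨ rearrange (ι (r !)) (ι (j !)) (sgn i) (ι (N C a)) (ι S₁) (ι S₂) (ι P) ⟩
    ι (N C a) * (sgn i * (ι (r !) * ι S₂ * ι P)) * (ι (j !) * ι S₁)
      ≡⟨ sym (cong₂ (λ x y → ι (N C a) * (sgn i * x) * y)
                    (trans (ℤP.pos-* (r ! ℕ.* S₂) P) (cong (_* ι P) (ℤP.pos-* (r !) S₂))) (ℤP.pos-* (j !) S₁)) ⟩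
    ι (N C a) * (sgn i * ι (r ! ℕ.* S₂ ℕ.* P)) * ι (j ! ℕ.* S₁)
      ≡⟨ sym (cong₂ (λ x y → ι (N C a) * x * y) (coeff-oneMinusExp^⊗-from n r i) (coeff-expm1^⊗ (N ∸ a) j)) ⟩
    ι (N C a) * coeff (oneMinusExp n ^⊗ r) a * coeff (expm1 ^⊗ j) (N ∸ a) ∎
    where
    a S₁ S₂ P : ℕ
    a  = r ℕ.+ i
    S₁ = stirling2 (N ∸ a) j
    S₂ = stirling2 a r
    P  = n ℕ.^ a
    rearrange : ∀ f h s c x y p → f * h * (s * c * x * y * p) ≡ c * (s * (f * y * p)) * (h * x)
    rearrange = solve-∀

  -- r!(k−r)! times the right-hand side is the (m+k)-th coefficient of Z^r (e^t − 1)^{k−r}: the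
  -- convolution terms of index below r and above m + r vanish, the others are the summands.
  rhs-coefficient : ∀ n m k r → 1 ≤ r → r ≤ k →
    ι (r ! ℕ.* (k ∸ r) !) * rhs-sum n m k r ≡ coeff (oneMinusExp n ^⊗ r ⊗ expm1 ^⊗ (k ∸ r)) (m ℕ.+ k)
  rhs-coefficient n m k r@(suc r′) (s≤s z≤n) r≤k = begin
    ι (r ! ℕ.* j !) * sumTo m g                 ≡⟨ sym (sumTo-*ˡ m (ι (r ! ℕ.* j !)) g) ⟩
    sumTo m (λ i → ι (r ! ℕ.* j !) * g i)       ≡⟨ sumTo-cong≤ m (λ i i≤m → rhs-summand n N r j i (a≤N i i≤m)) ⟩
    sumTo m (λ i → G (r ℕ.+ i))                 ≡⟨ sym (ℤP.+-identityˡ _) ⟩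
    0ℤ + sumTo m (λ i → G (r ℕ.+ i))            ≡⟨ cong (_+ sumTo m (λ i → G (r ℕ.+ i))) (sym below-r) ⟩
    sumTo r′ G + sumTo m (λ i → G (r ℕ.+ i))    ≡⟨ sym (sumTo-split r′ m G) ⟩
    sumTo (r′ ℕ.+ suc m) G                      ≡⟨ sym (sumTo-vanishing-tail (r′ ℕ.+ suc m) j G beyond-top) ⟩
    sumTo (r′ ℕ.+ suc m ℕ.+ j) G                ≡⟨ cong (λ t → sumTo t G) top≡N ⟩
    sumTo N G                                   ≡⟨ sym (coeff-⊗ (oneMinusExp n ^⊗ r) (expm1 ^⊗ j) N) ⟩
    coeff (oneMinusExp n ^⊗ r ⊗ expm1 ^⊗ j) N   ∎
    where
    N j : ℕ
    N = m ℕ.+ k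
    j = k ∸ r
    g G : ℕ → ℤ
    g i = sgn i * ι (N C (N ∸ r ∸ i)) * ι (stirling2 (N ∸ r ∸ i) j) * ι (stirling2 (r ℕ.+ i) r) * ι (n ℕ.^ (r ℕ.+ i))
    G a = ι (N C a) * coeff (oneMinusExp n ^⊗ r) a * coeff (expm1 ^⊗ j) (N ∸ a)
    a≤N : ∀ i → i ≤ m → r ℕ.+ i ≤ N
    a≤N i i≤m = subst (r ℕ.+ i ≤_) (ℕP.+-comm k m) (ℕP.+-mono-≤ r≤k i≤m)
    top≡N : r′ ℕ.+ suc m ℕ.+ j ≡ N
    top≡N = trans (regroup r′ m j) (cong (m ℕ.+_) (ℕP.m+[n∸m]≡n r≤k))
      where regroup : ∀ r′ m j → r′ ℕ.+ suc m ℕ.+ j ≡ m ℕ.+ (suc r′ ℕ.+ j)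
            regroup = ℕSolver.solve-∀
    below-r : sumTo r′ G ≡ 0ℤ
    below-r = trans (sumTo-cong≤ r′ G≡0) (sumTo-zero r′)
      where G≡0 : ∀ a → a ≤ r′ → G a ≡ 0ℤ
            G≡0 a a≤r′ = begin
              G a ≡⟨ cong (λ x → ι (N C a) * x * coeff (expm1 ^⊗ j) (N ∸ a)) (coeff-oneMinusExp^⊗-vanishes n r a (s≤s a≤r′)) ⟩
              ι (N C a) * 0ℤ * coeff (expm1 ^⊗ j) (N ∸ a) ≡⟨ cong (_* coeff (expm1 ^⊗ j) (N ∸ a)) (ℤP.*-zeroʳ (ι (N C a))) ⟩
              0ℤ * coeff (expm1 ^⊗ j) (N ∸ a) ≡⟨ ℤP.*-zeroˡ (coeff (expm1 ^⊗ j) (N ∸ a)) ⟩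
              0ℤ ∎
    beyond-top : ∀ q → r′ ℕ.+ suc m < q → q ≤ r′ ℕ.+ suc m ℕ.+ j → G q ≡ 0ℤ
    beyond-top q top<q q≤ =
      trans (cong (ι (N C q) * coeff (oneMinusExp n ^⊗ r) q *_)
                  (coeff-expm1^⊗-vanishes (N ∸ q) j (subst (λ t → t ∸ q < j) top≡N (∸-<-lower _ j q top<q q≤))))
            (ℤP.*-zeroʳ (ι (N C q) * coeff (oneMinusExp n ^⊗ r) q))

  -- Y^r (e^t − 1)^k = (Y (e^t − 1))^r (e^t − 1)^{k−r} = Z^r (e^t − 1)^{k−r}.
  power-sum-telescoping : ∀ n r k → r ≤ k →
    negExpSum n ^⊗ r ⊗ expm1 ^⊗ k ≈ oneMinusExp n ^⊗ r ⊗ expm1 ^⊗ (k ∸ r)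
  power-sum-telescoping n r k r≤k = ≈-trans (≡⇒≈ split-power) (⊗-congˡ (X ^⊗ j) merge)
    where
    X Y : ExpPoly
    X = expm1
    Y = negExpSum n
    j : ℕ
    j = k ∸ r
    split-power : Y ^⊗ r ⊗ X ^⊗ k ≡ Y ^⊗ r ⊗ X ^⊗ r ⊗ X ^⊗ j
    split-power = begin
      Y ^⊗ r ⊗ X ^⊗ k              ≡⟨ cong (λ t → Y ^⊗ r ⊗ X ^⊗ t) (sym (ℕP.m+[n∸m]≡n r≤k)) ⟩
      Y ^⊗ r ⊗ X ^⊗ (r ℕ.+ j)      ≡⟨ cong (Y ^⊗ r ⊗_) (^⊗-+ X r j) ⟩
      Y ^⊗ r ⊗ (X ^⊗ r ⊗ X ^⊗ j)   ≡⟨ sym (⊗-assoc (Y ^⊗ r) (X ^⊗ r) (X ^⊗ j)) ⟩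
      Y ^⊗ r ⊗ X ^⊗ r ⊗ X ^⊗ j     ∎
    merge : Y ^⊗ r ⊗ X ^⊗ r ≈ oneMinusExp n ^⊗ r
    merge = ≈-trans (^⊗-distrib-⊗ Y X r) (^⊗-cong r (negExpSum-telescopes n))

  factorial-split : ∀ {k r} → r ≤ k → k ! ≡ (k C r) ℕ.* (r ! ℕ.* (k ∸ r) !)
  factorial-split {k} {r} r≤k = sym (trans (cong (ℕ._* (r ! ℕ.* (k ∸ r) !)) (nCk≡n!/k![n-k]! r≤k))
                                           (m/n*n≡m {{r ℕP.!* (k ∸ r) !≢0}} (k![n∸k]!∣n! r≤k)))

  -- The theorem over ℤ, with the denominator C(k,r) cleared: both sides are the same
  -- coefficient after multiplying by r!(k−r)! resp. k! = C(k,r) r!(k−r)!.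
  integer-identity : ∀ n m k r → 1 ≤ r → r ≤ k → rhs-sum n m k r ≡ ι (k C r) * lhs-sum n m k r
  integer-identity n m k r 1≤r r≤k = ℤP.*-cancelˡ-≡ (ι F) rhs (ι (k C r) * lhs) {{F≢0}} (begin
    ι F * rhs                                                ≡⟨ rhs-coefficient n m k r 1≤r r≤k ⟩
    coeff (oneMinusExp n ^⊗ r ⊗ expm1 ^⊗ (k ∸ r)) (m ℕ.+ k)   ≡⟨ sym (power-sum-telescoping n r k r≤k .at (m ℕ.+ k)) ⟩
    coeff (negExpSum n ^⊗ r ⊗ expm1 ^⊗ k) (m ℕ.+ k)          ≡⟨ sym (lhs-coefficient n m k r) ⟩
    ι (k !) * lhs                                            ≡⟨ cong (λ x → ι x * lhs) (factorial-split r≤k) ⟩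
    ι ((k C r) ℕ.* F) * lhs                                  ≡⟨ cong (_* lhs) (trans (ℤP.pos-* (k C r) F) (ℤP.*-comm (ι (k C r)) (ι F))) ⟩
    ι F * ι (k C r) * lhs                                    ≡⟨ ℤP.*-assoc (ι F) (ι (k C r)) lhs ⟩
    ι F * (ι (k C r) * lhs)                                  ∎)
    where
    F : ℕ
    F = r ! ℕ.* (k ∸ r) !
    F≢0 : NonZero F
    F≢0 = r ℕP.!* (k ∸ r) !≢0
    lhs rhs : ℤ
    lhs = lhs-sum n m k r
    rhs = rhs-sum n m k r

  a/1≡b/d : ∀ (d : ℕ) .{{_ : NonZero d}} (a b : ℤ) → b ≡ ι d * a → a / 1 ≡ b / d
  a/1≡b/d (suc d) a b b≡da = fromℚᵘ-cong {mkℚᵘ a 0} {mkℚᵘ b d}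
    (*≡* (trans (ℤP.*-comm a (ι (suc d))) (trans (sym b≡da) (sym (ℤP.*-identityʳ b)))))

open import Defs
open import Data.Nat using (ℕ; _+_; _∸_; _^_; _≤_)
open import Data.Nat.Combinatorics using (_C_)
open import Data.Integer as ℤ using (ℤ)
open import Data.Rational using (ℚ; _/_)
open import Relation.Binary.PropositionalEquality using (_≡_)
open PowerSumIdentity using (integer-identity; a/1≡b/d)

proposition2p2 : (n m k r : ℕ) → 1 ≤ n → 1 ≤ r → (r≤k : r ≤ k) →
    (sumTo m (λ q → sgn q ℤ.* ℤ.+ ((m + k) C q) ℤ.* ℤ.+ (stirling2 (m + k ∸ q) k) ℤ.* ℤ.+ (powerSum r q n))) / 1
      ≡ _/_ (sumTo m (λ j → sgn j ℤ.* ℤ.+ ((m + k) C (m + k ∸ r ∸ j)) ℤ.* ℤ.+ (stirling2 (m + k ∸ r ∸ j) (k ∸ r)) ℤ.* ℤ.+ (stirling2 (r + j) r) ℤ.* ℤ.+ (n ^ (r + j))))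
          (k C r) {{C-nonZero r≤k}}
proposition2p2 n m k r _ 1≤r r≤k = a/1≡b/d (k C r) {{C-nonZero r≤k}} _ _ (integer-identity n m k r 1≤r r≤k)
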